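{- Let $t\geq 2$ be an integer and let $G$ be a graph with $v(G)\geq t+1$ and $e(G)\geq (t-1)\left(v(G)-t/2\right)$. Then $$\rho_t(G)\geq \rho_{t-1}(G) > \rho_{t-2}(G) > \cdots > \rho_0(G).$$
   Context: All graphs are finite and simple. For an integer $s\ge0$ and a graph $G$, the $s$-density is $\rho_s(G)=\dfrac{e(G)-\binom{s}{2}}{v(G)-s}$ if $e(G)>\binom{s}{2}$, and $\rho_s(G)=0$ otherwise. Thus $\rho_0(G)=e(G)/v(G)$ is the usual density. -}

module Defs where

open import Data.Bool using (Bool; true; false; if_then_else_)
open import Data.Nat using (ℕ; zero; suc; _+_; _*_; _∸_; _<ᵇ_)
open import Data.Nat.Combinatorics using (_C_)
open import Data.Fin using (Fin; toℕ)
open import Data.List using (List; map; allFin)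
open import Data.Nat.ListAction using (sum)
open import Data.Integer using (+_)
open import Data.Rational using (ℚ; 0ℚ; _/_)
open import Relation.Binary.PropositionalEquality using (_≡_)

record Graph (n : ℕ) : Set where
  field
    adj   : Fin n → Fin n → Bool
    sym   : ∀ i j → adj i j ≡ adj j i
    irrefl : ∀ i → adj i i ≡ false
open Graph public

v : ∀ {n} → Graph n → ℕ
v {n} _ = n

e : ∀ {n} → Graph n → ℕ
e {n} G = sum (map (λ i → sum (map (λ j →
            if toℕ i <ᵇ toℕ j then (if adj G i j then 1 else 0) else 0)
          (allFin n))) (allFin n))

-- s-density: (e - C(s,2)) / (v - s) if e > C(s,2), and 0 otherwise.
-- (For a graph, e > C(s,2) forces v > s, so the zero-denominator branch
--  is unreachable.)
ρ : ℕ → ∀ {n} → Graph n → ℚ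
ρ s G with (s C 2) <ᵇ e G | v G ∸ s
... | true  | suc d = (+ (e G ∸ (s C 2))) / suc d
... | true  | zero  = 0ℚ
... | false | _     = 0ℚ

-- With a = e − C(s,2) and d = n − s we have ρ s = a / d and ρ (s+1) = (a − s) / (d − 1),
-- so ρ s ≤ ρ (s+1) exactly when a ≥ s d, i.e. when e ≥ threshold n s = C(s,2) + s (n − s);
-- writing a = s d + w, the two densities are s + w/d and s + w/(d − 1).  The hypothesis
-- says e ≥ threshold n (t − 1), and threshold n s increases strictly in s (by n − s − 1
-- per step), so e exceeds every earlier threshold strictly.

module Submission where

open import Defs hiding (sym)
open import Data.Nat using (ℕ; _+_; _*_; _∸_; _≤_)
open import Data.Rational using (_<_)
import Data.Rational as ℚ
open import Data.Product using (_×_)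

open import Data.Product using (_,_)
open import Data.Bool using (true)
import Data.Nat as ℕ
open import Data.Nat using (zero; suc; s≤s; z<s; _<ᵇ_; >-nonZero)
open import Data.Nat.Properties
open import Data.Nat.Combinatorics using (_C_; nC1≡n; nCk+nC[k+1]≡[n+1]C[k+1])
open import Data.Nat.Tactic.RingSolver using (solve-∀)
open import Data.Integer using (+_)
import Data.Integer as ℤ
import Data.Integer.Properties as ℤₚ
import Data.Rational.Properties as ℚₚ
import Data.Rational.Unnormalised as ℚᵘ
import Data.Rational.Unnormalised.Properties as ℚᵘₚ
open import Data.Sum using (inj₁; inj₂)
open import Relation.Binary.PropositionalEquality

cross-≤⇒/≤/ : ∀ a b c d → a * suc d ≤ c * suc b → (+ a) ℚ./ suc b ℚ.≤ (+ c) ℚ./ suc d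
cross-≤⇒/≤/ a b c d ad≤cb = ℚₚ.toℚᵘ-cancel-≤
  (ℚᵘₚ.≤-respˡ-≃ (ℚᵘₚ.≃-sym (ℚₚ.toℚᵘ-fromℚᵘ (ℚᵘ.mkℚᵘ (+ a) b)))
  (ℚᵘₚ.≤-respʳ-≃ (ℚᵘₚ.≃-sym (ℚₚ.toℚᵘ-fromℚᵘ (ℚᵘ.mkℚᵘ (+ c) d)))
  (ℚᵘ.*≤* (subst₂ ℤ._≤_ (ℤₚ.pos-* a (suc d)) (ℤₚ.pos-* c (suc b)) (ℤ.+≤+ ad≤cb)))))

cross-<⇒/</ : ∀ a b c d → a * suc d ℕ.< c * suc b → (+ a) ℚ./ suc b < (+ c) ℚ./ suc d
cross-<⇒/</ a b c d ad<cb = ℚₚ.toℚᵘ-cancel-<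
  (ℚᵘₚ.<-respˡ-≃ (ℚᵘₚ.≃-sym (ℚₚ.toℚᵘ-fromℚᵘ (ℚᵘ.mkℚᵘ (+ a) b)))
  (ℚᵘₚ.<-respʳ-≃ (ℚᵘₚ.≃-sym (ℚₚ.toℚᵘ-fromℚᵘ (ℚᵘ.mkℚᵘ (+ c) d)))
  (ℚᵘ.*<* (subst₂ ℤ._<_ (ℤₚ.pos-* a (suc d)) (ℤₚ.pos-* c (suc b)) (ℤ.+<+ ad<cb)))))

[kq+w]*p≡kpq+wp : ∀ k w p q → (k * q + w) * p ≡ (k * p) * q + w * p
[kq+w]*p≡kpq+wp = solve-∀

[kq+w]/q-antitone-≤ : ∀ k w {p q} → p ≤ q →
  (+ (k * suc q + w)) ℚ./ suc q ℚ.≤ (+ (k * suc p + w)) ℚ./ suc p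
[kq+w]/q-antitone-≤ k w {p} {q} p≤q = cross-≤⇒/≤/ (k * suc q + w) q (k * suc p + w) p (begin
  (k * suc q + w) * suc p          ≡⟨ [kq+w]*p≡kpq+wp k w (suc p) (suc q) ⟩
  k * suc p * suc q + w * suc p    ≤⟨ +-monoʳ-≤ (k * suc p * suc q) (*-monoʳ-≤ w (s≤s p≤q)) ⟩
  k * suc p * suc q + w * suc q    ≡⟨ *-distribʳ-+ (suc q) (k * suc p) w ⟨
  (k * suc p + w) * suc q          ∎)
  where open ≤-Reasoning

[kq+w]/q-antitone-< : ∀ k w {p q} → 0 ℕ.< w → p ℕ.< q →
  (+ (k * suc q + w)) ℚ./ suc q < (+ (k * suc p + w)) ℚ./ suc p
[kq+w]/q-antitone-< k w {p} {q} 0<w p<q = cross-<⇒/</ (k * suc q + w) q (k * suc p + w) p (begin-strict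
  (k * suc q + w) * suc p          ≡⟨ [kq+w]*p≡kpq+wp k w (suc p) (suc q) ⟩
  k * suc p * suc q + w * suc p    <⟨ +-monoʳ-< (k * suc p * suc q) (*-monoʳ-< w {{>-nonZero 0<w}} (s≤s p<q)) ⟩
  k * suc p * suc q + w * suc q    ≡⟨ *-distribʳ-+ (suc q) (k * suc p) w ⟨
  (k * suc p + w) * suc q          ∎)
  where open ≤-Reasoning

[1+n]C2≡n+nC2 : ∀ n → suc n C 2 ≡ n + n C 2
[1+n]C2≡n+nC2 n = trans (sym (nCk+nC[k+1]≡[n+1]C[k+1] n 1)) (cong (_+ n C 2) (nC1≡n n))

2*[1+n]C2≡[1+n]*n : ∀ n → 2 * (suc n C 2) ≡ suc n * n
2*[1+n]C2≡[1+n]*n zero    = refl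
2*[1+n]C2≡[1+n]*n (suc n) = begin
  2 * (suc (suc n) C 2)           ≡⟨ cong (2 *_) ([1+n]C2≡n+nC2 (suc n)) ⟩
  2 * (suc n + suc n C 2)         ≡⟨ *-distribˡ-+ 2 (suc n) (suc n C 2) ⟩
  2 * suc n + 2 * (suc n C 2)     ≡⟨ cong (_+_ (2 * suc n)) (2*[1+n]C2≡[1+n]*n n) ⟩
  2 * suc n + suc n * n           ≡⟨ expand n ⟩
  suc (suc n) * suc n             ∎
  where
  open ≡-Reasoning
  expand : ∀ n → 2 * suc n + suc n * n ≡ suc (suc n) * suc n
  expand = solve-∀

ρ-unfold : ∀ s {n} (G : Graph n) {a d} → 0 ℕ.< a → e G ≡ s C 2 + a → n ≡ s + suc d →
  ρ s G ≡ (+ a) ℚ./ suc d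
ρ-unfold s G {a} {d} 0<a eG≡ refl
  -- abstracting the test together with a proof that it holds leaves only the true branch
  with s C 2 <ᵇ e G | <⇒<ᵇ (subst (s C 2 ℕ.<_) (sym eG≡) (m<m+n (s C 2) 0<a))
     | s + suc d ∸ s | m+n∸m≡n s (suc d)
... | true | _ | _ | refl =
  cong (λ x → (+ x) ℚ./ suc d) (trans (cong (_∸ s C 2) eG≡) (m+n∸m≡n (s C 2) a))

threshold : ℕ → ℕ → ℕ
threshold n s = s C 2 + s * (n ∸ s)

threshold-+ : ∀ s d → threshold (s + d) s ≡ s C 2 + s * d
threshold-+ s d = cong (λ x → s C 2 + s * x) (m+n∸m≡n s d)

threshold-suc : ∀ s {n} → s ℕ.< n → threshold n (suc s) ≡ threshold n s + (n ∸ suc s)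
threshold-suc s {n} s<n = begin
  suc s C 2 + suc s * m          ≡⟨ cong (λ x → x + suc s * m) ([1+n]C2≡n+nC2 s) ⟩
  s + s C 2 + (m + s * m)        ≡⟨ regroup s (s C 2) (s * m) m ⟩
  s C 2 + (s + s * m) + m        ≡⟨ cong (λ x → s C 2 + x + m) (*-suc s m) ⟨
  s C 2 + s * suc m + m          ≡⟨ cong (λ x → s C 2 + s * x + m) (+-∸-assoc 1 s<n) ⟨
  threshold n s + m              ∎
  where
  open ≡-Reasoning
  m = n ∸ suc s
  regroup : ∀ a b c d → a + b + (d + c) ≡ b + (a + c) + d
  regroup = solve-∀

threshold-<-suc : ∀ s {n} → suc s ℕ.< n → threshold n s ℕ.< threshold n (suc s)
threshold-<-suc s {n} 1+s<n = subst (threshold n s ℕ.<_) (sym (threshold-suc s (<⇒≤ 1+s<n)))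
  (m<m+n (threshold n s) (m<n⇒0<n∸m 1+s<n))

threshold-monoʳ-< : ∀ {n s s′} → s ℕ.< s′ → s′ ℕ.< n → threshold n s ℕ.< threshold n s′
threshold-monoʳ-< {s′ = suc s′} (s≤s s≤s′) 1+s′<n with m≤n⇒m<n∨m≡n s≤s′
... | inj₁ s<s′ = <-trans (threshold-monoʳ-< s<s′ (<⇒≤ 1+s′<n)) (threshold-<-suc s′ 1+s′<n)
... | inj₂ refl = threshold-<-suc s′ 1+s′<n

2*threshold≡s*[2n∸[1+s]] : ∀ s {n} → s ≤ n → 2 * threshold n s ≡ s * (2 * n ∸ suc s)
2*threshold≡s*[2n∸[1+s]] s {n} s≤n with m≤n⇒∃[o]m+o≡n s≤n
2*threshold≡s*[2n∸[1+s]] zero    s≤n | d , refl = refl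
2*threshold≡s*[2n∸[1+s]] (suc s) s≤n | d , refl = begin
  2 * threshold (suc s + d) (suc s)        ≡⟨ cong (2 *_) (threshold-+ (suc s) d) ⟩
  2 * (suc s C 2 + suc s * d)              ≡⟨ *-distribˡ-+ 2 (suc s C 2) (suc s * d) ⟩
  2 * (suc s C 2) + 2 * (suc s * d)        ≡⟨ cong (λ x → x + 2 * (suc s * d)) (2*[1+n]C2≡[1+n]*n s) ⟩
  suc s * s + 2 * (suc s * d)              ≡⟨ factor s d ⟩
  suc s * (s + 2 * d)                      ≡⟨ cong (suc s *_) (m+n∸m≡n (suc (suc s)) (s + 2 * d)) ⟨
  suc s * (suc (suc s) + (s + 2 * d) ∸ suc (suc s)) ≡⟨ cong (λ x → suc s * (x ∸ suc (suc s))) (double s d) ⟩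
  suc s * (2 * (suc s + d) ∸ suc (suc s))   ∎
  where
  open ≡-Reasoning
  factor : ∀ s d → suc s * s + 2 * (suc s * d) ≡ suc s * (s + 2 * d)
  factor = solve-∀
  double : ∀ s d → suc (suc s) + (s + 2 * d) ≡ 2 * (suc s + d)
  double = solve-∀

ρ-consecutive : ∀ s d w {n} (G : Graph n) → n ≡ s + suc (suc d) → threshold n s + w ≡ e G →
  0 ℕ.< s * suc d + w →
  ρ s G ≡ (+ (s * suc (suc d) + w)) ℚ./ suc (suc d) × ρ (suc s) G ≡ (+ (s * suc d + w)) ℚ./ suc d
ρ-consecutive s d w G refl T+w≡e 0<a =
    ρ-unfold s G (<-≤-trans 0<a (+-monoˡ-≤ w (*-monoʳ-≤ s (n≤1+n (suc d))))) eG≡ refl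
  , ρ-unfold (suc s) G 0<a eG≡′ (+-suc s (suc d))
  where
  open ≡-Reasoning
  eG≡ : e G ≡ s C 2 + (s * suc (suc d) + w)
  eG≡ = begin
    e G                               ≡⟨ T+w≡e ⟨
    threshold (s + suc (suc d)) s + w ≡⟨ cong (_+ w) (threshold-+ s (suc (suc d))) ⟩
    s C 2 + s * suc (suc d) + w       ≡⟨ +-assoc (s C 2) (s * suc (suc d)) w ⟩
    s C 2 + (s * suc (suc d) + w)     ∎
  regroup : ∀ a b c w → a + (b + c + w) ≡ b + a + (c + w)
  regroup = solve-∀
  eG≡′ : e G ≡ suc s C 2 + (s * suc d + w)
  eG≡′ = begin
    e G                               ≡⟨ eG≡ ⟩
    s C 2 + (s * suc (suc d) + w)     ≡⟨ cong (λ x → s C 2 + (x + w)) (*-suc s (suc d)) ⟩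
    s C 2 + (s + s * suc d + w)       ≡⟨ regroup (s C 2) s (s * suc d) w ⟩
    s + s C 2 + (s * suc d + w)       ≡⟨ cong (λ x → x + (s * suc d + w)) ([1+n]C2≡n+nC2 s) ⟨
    suc s C 2 + (s * suc d + w)       ∎

ρ≤ρ-suc : ∀ s {n} (G : Graph n) → 0 ℕ.< s → s + 2 ≤ n → threshold n s ≤ e G →
  ρ s G ℚ.≤ ρ (suc s) G
ρ≤ρ-suc s G 0<s s+2≤n T≤e with m≤n⇒∃[o]m+o≡n s+2≤n | m≤n⇒∃[o]m+o≡n T≤e
... | d , s+2+d≡n | w , T+w≡e =
  let ρs≡ , ρs+1≡ = ρ-consecutive s d w G (trans (sym s+2+d≡n) (+-assoc s 2 d)) T+w≡e
                      (<-≤-trans 0<s (≤-trans (m≤m*n s (suc d)) (m≤m+n (s * suc d) w)))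
  in subst₂ ℚ._≤_ (sym ρs≡) (sym ρs+1≡) ([kq+w]/q-antitone-≤ s w (n≤1+n d))

ρ<ρ-suc : ∀ s {n} (G : Graph n) → s + 2 ≤ n → threshold n s ℕ.< e G → ρ s G < ρ (suc s) G
ρ<ρ-suc s G s+2≤n T<e with m≤n⇒∃[o]m+o≡n s+2≤n | m≤n⇒∃[o]m+o≡n T<e
... | d , s+2+d≡n | w , 1+T+w≡e =
  let ρs≡ , ρs+1≡ = ρ-consecutive s d (suc w) G (trans (sym s+2+d≡n) (+-assoc s 2 d))
                      (trans (+-suc (threshold _ s) w) 1+T+w≡e) (<-≤-trans z<s (m≤n+m (suc w) (s * suc d)))
  in subst₂ _<_ (sym ρs≡) (sym ρs+1≡) ([kq+w]/q-antitone-< s (suc w) z<s (n<1+n d))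

proposition4 : (t : ℕ) → 2 ≤ t → ∀ {n} → (G : Graph n) →
    t + 1 ≤ v G →
    (t ∸ 1) * (2 * v G ∸ t) ≤ 2 * e G →
    (ρ (t ∸ 1) G ℚ.≤ ρ t G) ×
      (∀ s → 1 ≤ s → s ≤ t ∸ 1 → ρ (s ∸ 1) G < ρ s G)
proposition4 (suc k) (s≤s 1≤k) {n} G t+1≤n hyp = ρ≤ρ-suc k G 1≤k k+2≤n T≤e , ρ-strictly-increasing
  where
  k+2≤n : k + 2 ≤ n
  k+2≤n = subst (_≤ n) (sym (+-suc k 1)) t+1≤n
  k<n : k ℕ.< n
  k<n = <-≤-trans (m<m+n k z<s) k+2≤n
  T≤e : threshold n k ≤ e G
  T≤e = *-cancelˡ-≤ 2 (subst (_≤ 2 * e G) (sym (2*threshold≡s*[2n∸[1+s]] k (<⇒≤ k<n))) hyp)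
  ρ-strictly-increasing : ∀ s → 1 ≤ s → s ≤ k → ρ (s ∸ 1) G < ρ s G
  ρ-strictly-increasing (suc s) _ s<k = ρ<ρ-suc s G (≤-trans (+-monoˡ-≤ 2 (<⇒≤ s<k)) k+2≤n)
    (<-≤-trans (threshold-monoʳ-< s<k k<n) T≤e)
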